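{- There exists a multiset $D$ of deadlines that admits a 3-Visits schedule, such that in every feasible 3-Visits schedule for $D$ some task is visited at two (distinct) positions that both belong to the set of values of the discretized sequence of $D$.
   Context: 3-Visits: given a multiset of positive integers (deadlines) $D=\{d_1,\ldots,d_n\}$, a 3-Visits schedule is a sequence of length $3n$ with entries in $[n]$ (positions numbered $1,\ldots,3n$), containing each $i$ exactly three times, such that the first occurrence of $i$ is within the first $d_i$ positions and each later occurrence of $i$ is at most $d_i$ positions after the previous one. With $d_1\leq\cdots\leq d_n$, the discretized sequence of $D$ is $\langle a_1,\ldots,a_n\rangle$ with $a_n=d_n$ and $a_i=\min\{a_{i+1}-1,\ d_i\}$ for $i<n$; its values are regarded as positions of the schedule. -}

module Defs where

open import Data.Nat using (ℕ; zero; suc; _+_; _*_; _∸_; _≤_; _<_; _⊓_)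
open import Data.Nat.Properties using (≤-decTotalOrder)
open import Data.List using (List; []; _∷_; length; lookup)
open import Data.List.Relation.Unary.All using (All)
open import Data.List.Membership.Propositional using (_∈_)
open import Data.Fin using (Fin; toℕ)
open import Data.Product using (Σ; _×_; ∃-syntax)
open import Data.Sum using (_⊎_)
open import Relation.Binary.PropositionalEquality using (_≡_; _≢_)
import Data.List.Sort.InsertionSort.Base as InsSort

-- A multiset of deadlines D = {d_1,...,d_n} is represented by a list;
-- task i (i : Fin n) has deadline  lookup D i.
Deadlines : Set
Deadlines = List ℕ

Positive : Deadlines → Set
Positive D = All (λ d → 1 ≤ d) D

-- A candidate schedule: a sequence of length 3n with entries among the n tasks.
-- Position p : Fin (3 * n) stands for schedule position  toℕ p + 1  (1-based).
Schedule : ℕ → Set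
Schedule n = Fin (3 * n) → Fin n

pos : ∀ {m} → Fin m → ℕ
pos p = suc (toℕ p)

VisitsOK : ∀ {n} → Schedule n → Fin n → ℕ → Set
VisitsOK {n} s i d =
  Σ (Fin (3 * n)) λ p₁ → Σ (Fin (3 * n)) λ p₂ → Σ (Fin (3 * n)) λ p₃ →
    (s p₁ ≡ i) × (s p₂ ≡ i) × (s p₃ ≡ i) ×
    (pos p₁ < pos p₂) × (pos p₂ < pos p₃) ×
    (∀ q → s q ≡ i → (q ≡ p₁) ⊎ (q ≡ p₂) ⊎ (q ≡ p₃)) ×
    (pos p₁ ≤ d) × (pos p₂ ≤ pos p₁ + d) × (pos p₃ ≤ pos p₂ + d)

IsThreeVisitsSchedule : (D : Deadlines) → Schedule (length D) → Set
IsThreeVisitsSchedule D s = ∀ i → VisitsOK s i (lookup D i)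

sortD : List ℕ → List ℕ
sortD = InsSort.sort ≤-decTotalOrder

-- Natural-number truncated
-- subtraction turns nonpositive values into 0, which is never a schedule
-- position (positions are ≥ 1), so the set of values *regarded as positions*
-- is unaffected.
discretizeSorted : List ℕ → List ℕ
discretizeSorted [] = []
discretizeSorted (d ∷ []) = d ∷ []
discretizeSorted (d ∷ ds@(_ ∷ _)) with discretizeSorted ds
... | [] = d ∷ []                         -- unreachable (ds nonempty)
... | a ∷ as = ((a ∸ 1) ⊓ d) ∷ a ∷ as

discretized : Deadlines → List ℕ
discretized D = discretizeSorted (sortD D)

HasDoubleDiscreteVisit : (D : Deadlines) → Schedule (length D) → Set
HasDoubleDiscreteVisit D s =
  ∃[ i ] ∃[ p ] ∃[ q ] (p ≢ q) × (s p ≡ i) × (s q ≡ i) ×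
    (pos p ∈ discretized D) × (pos q ∈ discretized D)

{-# OPTIONS --safe #-}
-- Tasks 0 and 1 of D₀ = {3,3,5,6} have deadline 3, so each makes its first two visits within
-- positions 1–6, where every position except 1 and 4 is a value of the discretized sequence
-- ⟨2,3,5,6⟩. A task avoiding two such visits must start at 1 or make its second visit at 4.
-- The two tasks cannot do the same, so one starts at 1 while the other occupies 4; the first
-- then makes its second and third visits within {2,3,5,6}. The deadlines 5 and 6 only serve
-- to make 5 and 6 discretized values and the instance feasible.
module Submission where

open import Defs
open import Data.Bool using (T)
open import Data.Empty using (⊥-elim)
open import Data.Fin using (#_)
open import Data.Fin.Patterns using (0F; 1F; 2F; 3F)
open import Data.Fin.Properties using (toℕ-injective; all?; _≟_)
open import Data.List using ([]; _∷_; length)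
open import Data.List.Membership.Propositional using (_∈_)
open import Data.List.Relation.Unary.All using ([]; _∷_)
open import Data.List.Relation.Unary.Any using (here; there)
open import Data.Nat using (ℕ; suc; _+_; _≤_; _<_; _≤ᵇ_; s≤s; z≤n)
open import Data.Nat.Properties
  using (≤ᵇ⇒≤; ≤-trans; ≤-pred; <⇒≤; <⇒≢; <⇒≱; <-irrefl; ≤∧≢⇒<; +-monoˡ-≤; m≤m+n; m≤n⇒m≤n+o; suc-injective)
import Data.Nat.Properties as ℕ
open import Data.Product using (_×_; _,_; proj₁; ∃-syntax)
open import Data.Sum using (_⊎_; inj₁; inj₂)
open import Data.Vec using (_∷_; []; lookup)
open import Function using (_∘_)
open import Relation.Binary.PropositionalEquality using (_≡_; _≢_; refl; sym; trans; cong; subst)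
open import Relation.Unary using (_⊆_)
open import Relation.Nullary using (yes; no; contradiction)
open import Relation.Nullary.Decidable using (True; toWitness; _⊎-dec_; _→-dec_)

DoubleVisit : ∀ {n} → Schedule n → (ℕ → Set) → Set
DoubleVisit s P = ∃[ i ] ∃[ p ] ∃[ q ] (p ≢ q) × (s p ≡ i) × (s q ≡ i) × P (pos p) × P (pos q)

DoubleVisit-mono : ∀ {n} {s : Schedule n} {P Q : ℕ → Set} →
                   P ⊆ Q → DoubleVisit s P → DoubleVisit s Q
DoubleVisit-mono P⇒Q (i , p , q , p≢q , sp , sq , Pp , Pq) = i , p , q , p≢q , sp , sq , P⇒Q Pp , P⇒Q Pq

Key : ℕ → Set
Key x = 2 ≤ x × x ≤ 6 × x ≢ 4

first-two-visits : ∀ {a b} → 1 ≤ a → a < b → a ≤ 3 → b ≤ a + 3 → a ≡ 1 ⊎ b ≡ 4 ⊎ Key a × Key b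
first-two-visits {a} {b} 1≤a a<b a≤3 b≤a+3 with a ℕ.≟ 1 | b ℕ.≟ 4
... | yes a≡1 | _        = inj₁ a≡1
... | no _    | yes b≡4  = inj₂ (inj₁ b≡4)
... | no a≢1  | no b≢4   = inj₂ (inj₂ (key-a , key-b))
  where
  key-a : Key a
  key-a = ≤∧≢⇒< 1≤a (a≢1 ∘ sym) , m≤n⇒m≤n+o 3 a≤3 , <⇒≢ (s≤s a≤3)
  key-b : Key b
  key-b = ≤-trans (s≤s 1≤a) a<b , ≤-trans b≤a+3 (+-monoˡ-≤ 3 a≤3) , b≢4

later-visits-after-1 : ∀ {a b c} → a ≡ 1 → a < b → b ≤ a + 3 → b < c → c ≤ b + 3 → b ≢ 4 → c ≢ 4 →
                       Key b × Key c
later-visits-after-1 {b = b} refl 1<b b≤4 b<c c≤b+3 b≢4 c≢4 =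
  (1<b , m≤n⇒m≤n+o 3 b≤3 , b≢4) , (≤-trans 1<b (<⇒≤ b<c) , ≤-trans c≤b+3 (+-monoˡ-≤ 3 b≤3) , c≢4)
  where
  b≤3 : b ≤ 3
  b≤3 = ≤-pred (≤∧≢⇒< b≤4 b≢4)

module _ {n} {s : Schedule n} where

  distinct-tasks-apart : ∀ {u v p q} → u ≢ v → s p ≡ u → s q ≡ v → pos p ≢ pos q
  distinct-tasks-apart u≢v sp sq p≡q =
    u≢v (trans (sym sp) (trans (cong s (toℕ-injective (suc-injective p≡q))) sq))

  double-visit : ∀ {i p q} → s p ≡ i → s q ≡ i → pos p < pos q → Key (pos p) → Key (pos q) → DoubleVisit s Key
  double-visit sp sq p<q kp kq = _ , _ , _ , (λ p≡q → <-irrefl (cong pos p≡q) p<q) , sp , sq , kp , kq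

  start-at-1⇒DoubleVisit : ∀ {u v q} → u ≢ v → (U : VisitsOK s u 3) → pos (proj₁ U) ≡ 1 →
                           s q ≡ v → pos q ≡ 4 → DoubleVisit s Key
  start-at-1⇒DoubleVisit u≢v (_ , _ , _ , _ , s₂ , s₃ , a₁<a₂ , a₂<a₃ , _ , _ , a₂≤a₁+3 , a₃≤a₂+3) a₁≡1 sq q≡4 =
    let k₂ , k₃ = later-visits-after-1 a₁≡1 a₁<a₂ a₂≤a₁+3 a₂<a₃ a₃≤a₂+3 (not-at-q s₂) (not-at-q s₃)
    in double-visit s₂ s₃ a₂<a₃ k₂ k₃
    where
    not-at-q : ∀ {p} → s p ≡ _ → pos p ≢ 4
    not-at-q sp p≡4 = distinct-tasks-apart u≢v sp sq (trans p≡4 (sym q≡4))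

  two-deadline-3-tasks⇒DoubleVisit : ∀ {u v} → u ≢ v → VisitsOK s u 3 → VisitsOK s v 3 → DoubleVisit s Key
  two-deadline-3-tasks⇒DoubleVisit u≢v
    U@(_ , _ , _ , sa₁ , sa₂ , _ , a₁<a₂ , _ , _ , a₁≤3 , a₂≤a₁+3 , _)
    V@(_ , _ , _ , sb₁ , sb₂ , _ , b₁<b₂ , _ , _ , b₁≤3 , b₂≤b₁+3 , _)
    with first-two-visits (s≤s z≤n) a₁<a₂ a₁≤3 a₂≤a₁+3 | first-two-visits (s≤s z≤n) b₁<b₂ b₁≤3 b₂≤b₁+3
  ... | inj₂ (inj₂ (k₁ , k₂)) | _                     = double-visit sa₁ sa₂ a₁<a₂ k₁ k₂
  ... | _                     | inj₂ (inj₂ (k₁ , k₂)) = double-visit sb₁ sb₂ b₁<b₂ k₁ k₂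
  ... | inj₁ a₁≡1             | inj₁ b₁≡1             = ⊥-elim (distinct-tasks-apart u≢v sa₁ sb₁ (trans a₁≡1 (sym b₁≡1)))
  ... | inj₂ (inj₁ a₂≡4)      | inj₂ (inj₁ b₂≡4)      = ⊥-elim (distinct-tasks-apart u≢v sa₂ sb₂ (trans a₂≡4 (sym b₂≡4)))
  ... | inj₁ a₁≡1             | inj₂ (inj₁ b₂≡4)      = start-at-1⇒DoubleVisit u≢v U a₁≡1 sb₂ b₂≡4
  ... | inj₂ (inj₁ a₂≡4)      | inj₁ b₁≡1             = start-at-1⇒DoubleVisit (u≢v ∘ sym) V b₁≡1 sa₂ a₂≡4

occurs-only-at : ∀ {n} {s : Schedule n} {i p₁ p₂ p₃} →
  {checked : True (all? λ q → s q ≟ i →-dec (q ≟ p₁ ⊎-dec q ≟ p₂ ⊎-dec q ≟ p₃))} →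
  ∀ q → s q ≡ i → q ≡ p₁ ⊎ q ≡ p₂ ⊎ q ≡ p₃
occurs-only-at {checked = checked} = toWitness checked

≤-by-evaluation : ∀ {m n} {m≤ᵇn : T (m ≤ᵇ n)} → m ≤ n
≤-by-evaluation {m} {n} {m≤ᵇn} = ≤ᵇ⇒≤ m n m≤ᵇn

D₀ : Deadlines
D₀ = 3 ∷ 3 ∷ 5 ∷ 6 ∷ []

discretized-D₀ : discretized D₀ ≡ 2 ∷ 3 ∷ 5 ∷ 6 ∷ []
discretized-D₀ = refl

Key⇒discretized-D₀ : Key ⊆ (_∈ discretized D₀)
Key⇒discretized-D₀ {x} k = subst (x ∈_) (sym discretized-D₀) (Key⇒∈ k)
  where
  Key⇒∈ : ∀ {x} → Key x → x ∈ 2 ∷ 3 ∷ 5 ∷ 6 ∷ []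
  Key⇒∈ {0} (() , _)
  Key⇒∈ {1} (s≤s () , _)
  Key⇒∈ {2} _ = here refl
  Key⇒∈ {3} _ = there (here refl)
  Key⇒∈ {4} (_ , _ , 4≢4) = contradiction refl 4≢4
  Key⇒∈ {5} _ = there (there (here refl))
  Key⇒∈ {6} _ = there (there (there (here refl)))
  Key⇒∈ {suc (suc (suc (suc (suc (suc (suc x))))))} (_ , x≤6 , _) = contradiction x≤6 (<⇒≱ (m≤m+n 7 x))

s₀ : Schedule (length D₀)
s₀ = lookup (# 0 ∷ # 3 ∷ # 1 ∷ # 0 ∷ # 2 ∷ # 1 ∷ # 0 ∷ # 3 ∷ # 1 ∷ # 2 ∷ # 2 ∷ # 3 ∷ [])

s₀-feasible : IsThreeVisitsSchedule D₀ s₀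
s₀-feasible 0F = # 0 , # 3 , # 6 , refl , refl , refl , ≤-by-evaluation , ≤-by-evaluation , occurs-only-at ,
                 ≤-by-evaluation , ≤-by-evaluation , ≤-by-evaluation
s₀-feasible 1F = # 2 , # 5 , # 8 , refl , refl , refl , ≤-by-evaluation , ≤-by-evaluation , occurs-only-at ,
                 ≤-by-evaluation , ≤-by-evaluation , ≤-by-evaluation
s₀-feasible 2F = # 4 , # 9 , # 10 , refl , refl , refl , ≤-by-evaluation , ≤-by-evaluation , occurs-only-at ,
                 ≤-by-evaluation , ≤-by-evaluation , ≤-by-evaluation
s₀-feasible 3F = # 1 , # 7 , # 11 , refl , refl , refl , ≤-by-evaluation , ≤-by-evaluation , occurs-only-at ,
                 ≤-by-evaluation , ≤-by-evaluation , ≤-by-evaluation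

lemma18 : ∃[ D ] Positive D × (∃[ s ] IsThreeVisitsSchedule D s) ×
            (∀ (s : Schedule (length D)) → IsThreeVisitsSchedule D s → HasDoubleDiscreteVisit D s)
lemma18 = D₀ , (s≤s z≤n ∷ s≤s z≤n ∷ s≤s z≤n ∷ s≤s z≤n ∷ []) , (s₀ , s₀-feasible) , λ s feasible →
  DoubleVisit-mono {Q = _∈ discretized D₀} Key⇒discretized-D₀
    (two-deadline-3-tasks⇒DoubleVisit {u = 0F} {v = 1F} (λ ()) (feasible 0F) (feasible 1F))
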